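{- Let $k\ge1$ and let $\mu_1\ge\dots\ge\mu_k\ge1$ be integers; set $\mu_{k+1}=1$, $\mu_{k+2}=0$ and $p_j=\mu_j+k-j$ for $1\le j\le k$ (so $p_1>\dots>p_k\ge1$). Define $$f_k(p_1,\dots,p_k)=\frac{\big(p_1+\dots+p_k-k(k-1)/2\big)!\prod_{1\le i<j\le k}(p_i-p_j)^2}{\prod_{i=1}^k\big[(p_i-1)!\,(p_i+1)!\big]}$$ and $$g_k(\mu_1,\dots,\mu_k)=\frac{(\mu_1+\dots+\mu_k)!\prod_{1\le i<j\le k}(\mu_i-\mu_j+j-i)}{\prod_{i=1}^k(\mu_i-\mu_{i+1})!\cdot\prod_{1\le i<j\le k+1}(\mu_i-\mu_{j-1}+j-i)_{\mu_{j-1}-\mu_{j+1}+1}} .$$ Then $f_k(p_1,\dots,p_k)=g_k(\mu_1,\dots,\mu_k)$. Consequently $\sum_{p_1>\dots>p_k\ge1}f_k(p_1,\dots,p_k)=\sum_{\mu_1\ge\dots\ge\mu_k\ge1}g_k(\mu_1,\dots,\mu_k)$, so the identities asserting that each of these sums equals $1$ are the same identity.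
   Context: $(x)_n=x(x+1)\cdots(x+n-1)$ denotes the Pochhammer symbol, $(x)_0=1$. -}

module Defs where

open import Data.Nat using (ℕ; zero; suc; _+_; _*_; _∸_; _≤ᵇ_; _≡ᵇ_)
open import Data.Nat.DivMod using (_/_)
open import Data.Nat using (_!)
open import Data.Bool using (if_then_else_)
open import Data.Integer using (+_)
open import Data.Rational using (ℚ; 0ℚ)
import Data.Rational as ℚ

prodFrom : ℕ → ℕ → (ℕ → ℕ) → ℕ
prodFrom a zero    f = 1
prodFrom a (suc n) f = f a * prodFrom (suc a) n f

sumFrom : ℕ → ℕ → (ℕ → ℕ) → ℕ
sumFrom a zero    f = 0
sumFrom a (suc n) f = f a + sumFrom (suc a) n f

prodR : ℕ → ℕ → (ℕ → ℕ) → ℕ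
prodR a b f = prodFrom a (suc b ∸ a) f

sumR : ℕ → ℕ → (ℕ → ℕ) → ℕ
sumR a b f = sumFrom a (suc b ∸ a) f

∏pairs : ℕ → (ℕ → ℕ → ℕ) → ℕ
∏pairs m F = prodR 1 m (λ i → prodR (suc i) m (λ j → F i j))

poch : ℕ → ℕ → ℕ
poch x zero    = 1
poch x (suc n) = x * poch (suc x) n

-- a / d as a rational; denominators used below are always positive,
-- the value at d = 0 is an irrelevant junk value.
frac : ℕ → ℕ → ℚ
frac a zero    = 0ℚ
frac a (suc d) = (+ a) ℚ./ suc d

ext : ℕ → (ℕ → ℕ) → ℕ → ℕ
ext k μ i = if i ≤ᵇ k then μ i else (if i ≡ᵇ suc k then 1 else 0)

fk : (k : ℕ) → (ℕ → ℕ) → ℚ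
fk k p = frac num den
  where
  num = ((sumR 1 k p ∸ (k * (k ∸ 1)) / 2) !)
        * ∏pairs k (λ i j → (p i ∸ p j) * (p i ∸ p j))
  den = prodR 1 k (λ i → ((p i ∸ 1) !) * ((p i + 1) !))

gk : (k : ℕ) → (ℕ → ℕ) → ℚ
gk k μ = frac num den
  where
  μ̂ = ext k μ
  num = ((sumR 1 k μ) !) * ∏pairs k (λ i j → μ i ∸ μ j + (j ∸ i))
  den = prodR 1 k (λ i → (μ̂ i ∸ μ̂ (suc i)) !)
        * ∏pairs (suc k) (λ i j →
            poch (μ̂ i ∸ μ̂ (j ∸ 1) + (j ∸ i)) (μ̂ (j ∸ 1) ∸ μ̂ (suc j) + 1))

-- Extend μ by e (k+1) = 1 and e (k+2) = 0, fix a row i and put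
-- R l = (e i - e l + l - i)! (e i - e (l+1) + l - i)!.  The j-th Pochhammer
-- factor of row i times the gap e i - e j + j - i is exactly R j / R (j-1),
-- so (e i - e (i+1))! times the factors and gaps with i < j ≤ k telescopes to
-- R k, and R k times the last factor (j = k+1) is (p i - 1)! (p i + 1)!.
-- The gaps μ i - μ j + j - i are the differences p i - p j, and the k - j sum
-- to k(k-1)/2, so f_k and g_k have the same numerator (μ_1 + … + μ_k)! ∏ (p i - p j)
-- up to one factor ∏ (p i - p j), which is the ratio of their denominators.
module Submission where

open import Defs
open import Data.Nat using (ℕ; zero; suc; _+_; _*_; _∸_; _!; _≤_; _<_; z<s; s≤s; s≤s⁻¹; _≤′_; ≤′-refl; ≤′-step; _≤ᵇ_; _≡ᵇ_; NonZero)
open import Data.Nat.Properties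
open import Data.Nat.DivMod using (_/_; m*n/n≡m)
open import Data.Nat.Tactic.RingSolver using (solve-∀)
open import Data.Bool using (true; false)
import Data.Integer as ℤ
import Data.Integer.Properties as ℤP
import Data.Rational.Properties as ℚ
import Data.Rational.Unnormalised as ℚᵘ
open import Data.Sum using (inj₁; inj₂)
open import Relation.Nullary using (yes; no; contradiction)
open import Relation.Binary.PropositionalEquality using (_≡_; refl; sym; trans; cong; cong₂; subst; subst₂; module ≡-Reasoning)

open ≡-Reasoning

prodFrom-* : ∀ a n (f g : ℕ → ℕ) →
  prodFrom a n (λ i → f i * g i) ≡ prodFrom a n f * prodFrom a n g
prodFrom-* a zero    f g = refl
prodFrom-* a (suc n) f g = begin
  f a * g a * prodFrom (suc a) n (λ i → f i * g i)
    ≡⟨ cong (f a * g a *_) (prodFrom-* (suc a) n f g) ⟩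
  f a * g a * (prodFrom (suc a) n f * prodFrom (suc a) n g)
    ≡⟨ interchange (f a) (g a) _ _ ⟩
  f a * prodFrom (suc a) n f * (g a * prodFrom (suc a) n g) ∎
  where
  interchange : ∀ w x y z → w * x * (y * z) ≡ w * y * (x * z)
  interchange = solve-∀

prodFrom-cong : ∀ a n {f g : ℕ → ℕ} → (∀ i → a ≤ i → i < a + n → f i ≡ g i) →
  prodFrom a n f ≡ prodFrom a n g
prodFrom-cong a zero    f≗g = refl
prodFrom-cong a (suc n) f≗g = cong₂ _*_
  (f≗g a ≤-refl (m<m+n a z<s))
  (prodFrom-cong (suc a) n (λ i a<i i<a+n →
    f≗g i (<⇒≤ a<i) (subst (i <_) (sym (+-suc a n)) i<a+n)))

prodFrom-snoc : ∀ a n (f : ℕ → ℕ) → prodFrom a (suc n) f ≡ prodFrom a n f * f (a + n)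
prodFrom-snoc a zero    f = trans (*-identityʳ (f a)) (trans (cong f (sym (+-identityʳ a))) (sym (*-identityˡ _)))
prodFrom-snoc a (suc n) f = begin
  f a * prodFrom (suc a) (suc n) f       ≡⟨ cong (f a *_) (prodFrom-snoc (suc a) n f) ⟩
  f a * (prodFrom (suc a) n f * f (suc a + n)) ≡⟨ sym (*-assoc (f a) _ _) ⟩
  f a * prodFrom (suc a) n f * f (suc a + n)   ≡⟨ cong (λ x → f a * prodFrom (suc a) n f * f x) (sym (+-suc a n)) ⟩
  f a * prodFrom (suc a) n f * f (a + suc n)   ∎

prodFrom-telescope : ∀ (u F : ℕ → ℕ) a n →
  (∀ l → a ≤ l → l < a + n → u (suc l) ≡ u l * F (suc l)) →
  u a * prodFrom (suc a) n F ≡ u (a + n)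
prodFrom-telescope u F a zero    step = trans (*-identityʳ (u a)) (cong u (sym (+-identityʳ a)))
prodFrom-telescope u F a (suc n) step = begin
  u a * (F (suc a) * prodFrom (suc (suc a)) n F) ≡⟨ sym (*-assoc (u a) _ _) ⟩
  u a * F (suc a) * prodFrom (suc (suc a)) n F   ≡⟨ cong (_* _) (sym (step a ≤-refl (m<m+n a z<s))) ⟩
  u (suc a) * prodFrom (suc (suc a)) n F         ≡⟨ prodFrom-telescope u F (suc a) n step′ ⟩
  u (suc a + n)                                 ≡⟨ cong u (sym (+-suc a n)) ⟩
  u (a + suc n)                                 ∎
  where
  step′ : ∀ l → suc a ≤ l → l < suc a + n → u (suc l) ≡ u l * F (suc l)
  step′ l a<l l<a+n = step l (<⇒≤ a<l) (subst (l <_) (sym (+-suc a n)) l<a+n)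

prodFrom-nonZero : ∀ a n (f : ℕ → ℕ) → (∀ i → NonZero (f i)) → NonZero (prodFrom a n f)
prodFrom-nonZero a zero    f f≢0 = _
prodFrom-nonZero a (suc n) f f≢0 =
  m*n≢0 (f a) (prodFrom (suc a) n f) {{f≢0 a}} {{prodFrom-nonZero (suc a) n f f≢0}}

i<a+[1+b∸a]⇒i≤b : ∀ {a b i} → a ≤ i → i < a + (suc b ∸ a) → i ≤ b
i<a+[1+b∸a]⇒i≤b {a} {b} {i} a≤i i<end with a ≤? suc b
... | yes a≤1+b = s≤s⁻¹ (subst (i <_) (m+[n∸m]≡n a≤1+b) i<end)
... | no  a≰1+b = contradiction i<a (≤⇒≯ a≤i)
  where
  i<a : i < a
  i<a = subst (i <_) (trans (cong (a +_) (m≤n⇒m∸n≡0 (<⇒≤ (≰⇒> a≰1+b)))) (+-identityʳ a)) i<end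

prodR-cong : ∀ a b {f g : ℕ → ℕ} → (∀ i → a ≤ i → i ≤ b → f i ≡ g i) → prodR a b f ≡ prodR a b g
prodR-cong a b f≗g = prodFrom-cong a (suc b ∸ a) (λ i a≤i i<end → f≗g i a≤i (i<a+[1+b∸a]⇒i≤b a≤i i<end))

∏pairs-cong : ∀ m {F G : ℕ → ℕ → ℕ} → (∀ i j → 1 ≤ i → i < j → j ≤ m → F i j ≡ G i j) →
  ∏pairs m F ≡ ∏pairs m G
∏pairs-cong m F≗G = prodR-cong 1 m (λ i 1≤i _ → prodR-cong (suc i) m (λ j i<j j≤m → F≗G i j 1≤i i<j j≤m))

∏pairs-* : ∀ m (F G : ℕ → ℕ → ℕ) → ∏pairs m (λ i j → F i j * G i j) ≡ ∏pairs m F * ∏pairs m G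
∏pairs-* m F G = trans
  (prodFrom-cong 1 m (λ i _ _ → prodFrom-* (suc i) (suc m ∸ suc i) (F i) (G i)))
  (prodFrom-* 1 m _ _)

sumFrom-+ : ∀ a n (f g : ℕ → ℕ) → sumFrom a n (λ i → f i + g i) ≡ sumFrom a n f + sumFrom a n g
sumFrom-+ a zero    f g = refl
sumFrom-+ a (suc n) f g = begin
  f a + g a + sumFrom (suc a) n (λ i → f i + g i)
    ≡⟨ cong (f a + g a +_) (sumFrom-+ (suc a) n f g) ⟩
  f a + g a + (sumFrom (suc a) n f + sumFrom (suc a) n g)
    ≡⟨ interchange (f a) (g a) _ _ ⟩
  f a + sumFrom (suc a) n f + (g a + sumFrom (suc a) n g) ∎
  where
  interchange : ∀ w x y z → w + x + (y + z) ≡ w + y + (x + z)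
  interchange = solve-∀

sumFrom-countdown : ∀ a n → sumFrom a n (λ j → a + n ∸ suc j) * 2 ≡ n * (n ∸ 1)
sumFrom-countdown a zero    = refl
sumFrom-countdown a (suc n) rewrite +-suc a n | m+n∸m≡n a n =
  double-step n (sumFrom-countdown (suc a) n)
  where
  double-step : ∀ n {S} → S * 2 ≡ n * (n ∸ 1) → (n + S) * 2 ≡ suc n * n
  double-step zero    S*2≡0 = S*2≡0
  double-step (suc m) {S} S*2≡ = begin
    (suc m + S) * 2         ≡⟨ distrib (suc m) S ⟩
    suc m * 2 + S * 2       ≡⟨ cong (suc m * 2 +_) S*2≡ ⟩
    suc m * 2 + suc m * m   ≡⟨ collect m ⟩
    suc (suc m) * suc m     ∎
    where
    distrib : ∀ x y → (x + y) * 2 ≡ x * 2 + y * 2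
    distrib = solve-∀
    collect : ∀ m → suc m * 2 + suc m * m ≡ suc (suc m) * suc m
    collect = solve-∀

AntitoneOn : (ℕ → ℕ) → ℕ → ℕ → Set
AntitoneOn e a b = ∀ l → a ≤ l → l < b → e (suc l) ≤ e l

antitoneOn-≤ : ∀ {e a b i j} → AntitoneOn e a b → a ≤ i → i ≤ j → j ≤ b → e j ≤ e i
antitoneOn-≤ {e} {a} {b} {i} anti a≤i i≤j = go (≤⇒≤′ i≤j)
  where
  go : ∀ {j} → i ≤′ j → j ≤ b → e j ≤ e i
  go ≤′-refl                  _     = ≤-refl
  go (≤′-step {l} i≤′l) 1+l≤b = ≤-trans (anti l (≤-trans a≤i (≤′⇒≤ i≤′l)) 1+l≤b) (go i≤′l (<⇒≤ 1+l≤b))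

∸-split : ∀ {a b c} → c ≤ b → b ≤ a → a ∸ c ≡ (a ∸ b) + (b ∸ c)
∸-split {a} {b} {c} c≤b b≤a = begin
  a ∸ c             ≡⟨ cong (_∸ c) (sym (m∸n+n≡m b≤a)) ⟩
  (a ∸ b) + b ∸ c   ≡⟨ +-∸-assoc (a ∸ b) c≤b ⟩
  (a ∸ b) + (b ∸ c) ∎

poch-factorial : ∀ x n → x ! * poch (suc x) n ≡ (x + n) !
poch-factorial x zero    = trans (*-identityʳ (x !)) (cong _! (sym (+-identityʳ x)))
poch-factorial x (suc n) = begin
  x ! * (suc x * poch (suc (suc x)) n) ≡⟨ sym (*-assoc (x !) (suc x) _) ⟩
  x ! * suc x * poch (suc (suc x)) n   ≡⟨ cong (_* poch (suc (suc x)) n) (*-comm (x !) (suc x)) ⟩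
  suc x ! * poch (suc (suc x)) n       ≡⟨ poch-factorial (suc x) n ⟩
  (suc x + n) !                        ≡⟨ cong _! (sym (+-suc x n)) ⟩
  (x + suc n) !                        ∎

factorialPair-step : ∀ x a b n →
  (x + a + suc n) ! * (x + a + b + suc n) !
    ≡ (x + n) ! * (x + a + n) ! * (poch (x + suc n) (a + b + 1) * (x + a + suc n))
factorialPair-step x a b n = begin
  (x + a + suc n) ! * (x + a + b + suc n) !               ≡⟨ cong₂ _*_ (sym last) (sym first) ⟩
  (x + a + n) ! * (x + a + suc n) * ((x + n) ! * poch (x + suc n) (a + b + 1))
    ≡⟨ rearrange ((x + a + n) !) (x + a + suc n) ((x + n) !) _ ⟩
  (x + n) ! * (x + a + n) ! * (poch (x + suc n) (a + b + 1) * (x + a + suc n)) ∎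
  where
  last : (x + a + n) ! * (x + a + suc n) ≡ (x + a + suc n) !
  last = trans (cong ((x + a + n) ! *_) (+-suc (x + a) n))
    (trans (*-comm ((x + a + n) !) _) (cong _! (sym (+-suc (x + a) n))))
  shift : ∀ x a b n → x + n + (a + b + 1) ≡ x + a + b + suc n
  shift = solve-∀
  first : (x + n) ! * poch (x + suc n) (a + b + 1) ≡ (x + a + b + suc n) !
  first = trans (cong (λ y → (x + n) ! * poch y (a + b + 1)) (+-suc x n))
    (trans (poch-factorial (x + n) (a + b + 1)) (cong _! (shift x a b n)))
  rearrange : ∀ u v w z → u * v * (w * z) ≡ w * u * (z * v)
  rearrange = solve-∀

factorialPair-close : ∀ x y m → y ≤ x → 1 ≤ x →
  (x ∸ y + m) ! * (x ∸ 1 + m) ! * poch (x ∸ y + suc m) (y + 1) ≡ (x + m ∸ 1) ! * (x + m + 1) !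
factorialPair-close x y m y≤x 1≤x = begin
  (x ∸ y + m) ! * (x ∸ 1 + m) ! * poch (x ∸ y + suc m) (y + 1)
    ≡⟨ cong (λ z → (x ∸ y + m) ! * (x ∸ 1 + m) ! * poch z (y + 1)) (+-suc (x ∸ y) m) ⟩
  (x ∸ y + m) ! * (x ∸ 1 + m) ! * poch (suc (x ∸ y + m)) (y + 1)
    ≡⟨ swap ((x ∸ y + m) !) ((x ∸ 1 + m) !) _ ⟩
  (x ∸ 1 + m) ! * ((x ∸ y + m) ! * poch (suc (x ∸ y + m)) (y + 1))
    ≡⟨ cong₂ (λ u v → u ! * v) (sym (+-∸-comm m 1≤x)) (poch-factorial (x ∸ y + m) (y + 1)) ⟩
  (x + m ∸ 1) ! * (x ∸ y + m + (y + 1)) !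
    ≡⟨ cong (λ z → (x + m ∸ 1) ! * z !) (trans (regroup (x ∸ y) y m) (cong (λ z → z + m + 1) (m∸n+n≡m y≤x))) ⟩
  (x + m ∸ 1) ! * (x + m + 1) ! ∎
  where
  swap : ∀ u v w → u * v * w ≡ v * (u * w)
  swap = solve-∀
  regroup : ∀ a y m → a + m + (y + 1) ≡ a + y + m + 1
  regroup = solve-∀

gap : (ℕ → ℕ) → ℕ → ℕ → ℕ
gap e i j = e i ∸ e j + (j ∸ i)

pochFactor : (ℕ → ℕ) → ℕ → ℕ → ℕ
pochFactor e i j = poch (e i ∸ e (j ∸ 1) + (j ∸ i)) (e (j ∸ 1) ∸ e (suc j) + 1)

module Row (e : ℕ → ℕ) (i : ℕ) where

  partialRow : ℕ → ℕ
  partialRow l = (e i ∸ e l + (l ∸ i)) ! * (e i ∸ e (suc l) + (l ∸ i)) !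

  partialRow-start : partialRow i ≡ (e i ∸ e (suc i)) !
  partialRow-start = begin
    (e i ∸ e i + (i ∸ i)) ! * (e i ∸ e (suc i) + (i ∸ i)) !
      ≡⟨ cong₂ (λ x y → (x + y) ! * (e i ∸ e (suc i) + y) !) (n∸n≡0 (e i)) (n∸n≡0 i) ⟩
    1 * (e i ∸ e (suc i) + 0) !  ≡⟨ *-identityˡ _ ⟩
    (e i ∸ e (suc i) + 0) !      ≡⟨ cong _! (+-identityʳ (e i ∸ e (suc i))) ⟩
    (e i ∸ e (suc i)) !          ∎

  partialRow-step : ∀ l → i ≤ l → e l ≤ e i → e (suc l) ≤ e l → e (suc (suc l)) ≤ e (suc l) →
    partialRow (suc l) ≡ partialRow l * (pochFactor e i (suc l) * gap e i (suc l))
  partialRow-step l i≤l el≤ei e1≤el e2≤e1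
    -- write every difference through the consecutive drops e i ∸ e l, e l ∸ e (l+1), e (l+1) ∸ e (l+2)
    rewrite ∸-split e2≤e1 (≤-trans e1≤el el≤ei) | ∸-split e1≤el el≤ei
          | ∸-split e2≤e1 e1≤el | +-∸-assoc 1 i≤l
    = factorialPair-step (e i ∸ e l) (e l ∸ e (suc l)) (e (suc l) ∸ e (suc (suc l))) (l ∸ i)

  row-telescope : ∀ b → i ≤ b → AntitoneOn e i (suc b) →
    (e i ∸ e (suc i)) ! * prodFrom (suc i) (b ∸ i) (λ j → pochFactor e i j * gap e i j)
      ≡ partialRow b
  row-telescope b i≤b anti = begin
    (e i ∸ e (suc i)) ! * prodFrom (suc i) (b ∸ i) F  ≡⟨ cong (_* prodFrom (suc i) (b ∸ i) F) (sym partialRow-start) ⟩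
    partialRow i * prodFrom (suc i) (b ∸ i) F         ≡⟨ prodFrom-telescope partialRow F i (b ∸ i) step ⟩
    partialRow (i + (b ∸ i))                          ≡⟨ cong partialRow (m+[n∸m]≡n i≤b) ⟩
    partialRow b                                      ∎
    where
    F : ℕ → ℕ
    F j = pochFactor e i j * gap e i j
    step : ∀ l → i ≤ l → l < i + (b ∸ i) → partialRow (suc l) ≡ partialRow l * F (suc l)
    step l i≤l l<end = partialRow-step l i≤l
      (antitoneOn-≤ anti ≤-refl i≤l (≤-trans (<⇒≤ l<b) (n≤1+n b)))
      (anti l i≤l (m≤n⇒m≤1+n l<b))
      (anti (suc l) (m≤n⇒m≤1+n i≤l) (s≤s l<b))
      where
      l<b : l < b
      l<b = subst (l <_) (m+[n∸m]≡n i≤b) l<end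

ext-≤ : ∀ k μ {j} → j ≤ k → ext k μ j ≡ μ j
ext-≤ k μ {j} j≤k with j ≤ᵇ k | ≤⇒≤ᵇ j≤k
... | true  | _  = refl
... | false | ()

ext-suc : ∀ k μ → ext k μ (suc k) ≡ 1
ext-suc k μ with suc k ≤ᵇ k | ≤ᵇ⇒≤ (suc k) k | suc k ≡ᵇ suc k | ≡⇒≡ᵇ (suc k) (suc k) refl
... | true  | 1+k≤k | _    | _ = contradiction (1+k≤k _) (n≮n k)
... | false | _     | true | _ = refl

ext-suc-suc : ∀ k μ → ext k μ (suc (suc k)) ≡ 0
ext-suc-suc k μ with suc (suc k) ≤ᵇ k | ≤ᵇ⇒≤ (suc (suc k)) k | suc (suc k) ≡ᵇ suc k | ≡ᵇ⇒≡ (suc (suc k)) (suc k)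
... | true  | 2+k≤k | _     | _       = contradiction (2+k≤k _) (m+n≮n 1 k)
... | false | _     | true  | 2+k≡1+k = contradiction (2+k≡1+k _) 1+n≢n
... | false | _     | false | _       = refl

frac-cross : ∀ a b c d .{{_ : NonZero b}} .{{_ : NonZero d}} → a * d ≡ c * b → frac a b ≡ frac c d
frac-cross a (suc b) c (suc d) ad≡cb =
  ℚ.fromℚᵘ-cong {ℚᵘ.mkℚᵘ (ℤ.+ a) b} {ℚᵘ.mkℚᵘ (ℤ.+ c) d} (ℚᵘ.*≡* (begin
  ℤ.+ a ℤ.* ℤ.+ suc d ≡⟨ ℤP.pos-* a (suc d) ⟨
  ℤ.+ (a * suc d)     ≡⟨ cong ℤ.+_ ad≡cb ⟩
  ℤ.+ (c * suc b)     ≡⟨ ℤP.pos-* c (suc b) ⟩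
  ℤ.+ c ℤ.* ℤ.+ suc b ∎))

module Partition (k : ℕ) (μ : ℕ → ℕ) (μ-antitone : AntitoneOn μ 1 k) (1≤μk : 1 ≤ μ k) where

  private
    e : ℕ → ℕ
    e = ext k μ

    p : ℕ → ℕ
    p j = μ j + (k ∸ j)

  ext-antitone : AntitoneOn e 1 (suc k)
  ext-antitone l 1≤l l<1+k with m≤n⇒m<n∨m≡n (s≤s⁻¹ l<1+k)
  ... | inj₁ l<k  = subst₂ _≤_ (sym (ext-≤ k μ l<k)) (sym (ext-≤ k μ (<⇒≤ l<k))) (μ-antitone l 1≤l l<k)
  ... | inj₂ refl = subst₂ _≤_ (sym (ext-suc k μ)) (sym (ext-≤ k μ ≤-refl)) 1≤μk

  p∸p≡gap : ∀ {i j} → 1 ≤ i → i ≤ j → j ≤ k → p i ∸ p j ≡ gap μ i j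
  p∸p≡gap {i} {j} 1≤i i≤j j≤k = begin
    μ i + (k ∸ i) ∸ (μ j + (k ∸ j))
      ≡⟨ cong (λ z → μ i + z ∸ (μ j + (k ∸ j))) k∸i≡ ⟩
    μ i + ((k ∸ j) + (j ∸ i)) ∸ (μ j + (k ∸ j))
      ≡⟨ cong₂ _∸_ (exchange (μ i) (k ∸ j) (j ∸ i)) (+-comm (μ j) (k ∸ j)) ⟩
    (k ∸ j) + (μ i + (j ∸ i)) ∸ ((k ∸ j) + μ j)
      ≡⟨ [m+n]∸[m+o]≡n∸o (k ∸ j) _ (μ j) ⟩
    μ i + (j ∸ i) ∸ μ j
      ≡⟨ +-∸-comm (j ∸ i) (antitoneOn-≤ μ-antitone 1≤i i≤j j≤k) ⟩
    gap μ i j ∎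
    where
    k∸i≡ : k ∸ i ≡ (k ∸ j) + (j ∸ i)
    k∸i≡ = ∸-split i≤j j≤k
    exchange : ∀ a b c → a + (b + c) ≡ b + (a + c)
    exchange = solve-∀

  partialRow-close : ∀ {i} → 1 ≤ i → i ≤ k →
    Row.partialRow e i k * pochFactor e i (suc k) ≡ (p i ∸ 1) ! * (p i + 1) !
  partialRow-close {i} 1≤i i≤k
    rewrite ext-≤ k μ i≤k | ext-≤ k μ (≤-refl {k}) | ext-suc k μ | ext-suc-suc k μ | +-∸-assoc 1 i≤k
    = factorialPair-close (μ i) (μ k) (k ∸ i) μk≤μi (≤-trans 1≤μk μk≤μi)
    where
    μk≤μi : μ k ≤ μ i
    μk≤μi = antitoneOn-≤ μ-antitone 1≤i i≤k ≤-refl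

  row-identity : ∀ {i} → 1 ≤ i → i ≤ k →
    (e i ∸ e (suc i)) ! * prodFrom (suc i) (suc k ∸ i) (pochFactor e i) * prodFrom (suc i) (k ∸ i) (gap μ i)
      ≡ (p i ∸ 1) ! * (p i + 1) !
  row-identity {i} 1≤i i≤k = begin
    A * prodFrom (suc i) (suc k ∸ i) P * G
      ≡⟨ cong (λ n → A * prodFrom (suc i) n P * G) (+-∸-assoc 1 i≤k) ⟩
    A * prodFrom (suc i) (suc m) P * G
      ≡⟨ cong (λ x → A * x * G) (prodFrom-snoc (suc i) m P) ⟩
    A * (prodFrom (suc i) m P * P (suc i + m)) * G
      ≡⟨ rearrange A (prodFrom (suc i) m P) _ G ⟩
    A * (prodFrom (suc i) m P * G) * P (suc (i + m))
      ≡⟨ cong₂ (λ x y → A * x * P (suc y)) (sym PG) (m+[n∸m]≡n i≤k) ⟩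
    A * prodFrom (suc i) m (λ j → P j * gap e i j) * P (suc k)
      ≡⟨ cong (_* P (suc k)) (Row.row-telescope e i k i≤k anti) ⟩
    Row.partialRow e i k * P (suc k)
      ≡⟨ partialRow-close 1≤i i≤k ⟩
    (p i ∸ 1) ! * (p i + 1) ! ∎
    where
    m = k ∸ i
    A = (e i ∸ e (suc i)) !
    P = pochFactor e i
    G = prodFrom (suc i) m (gap μ i)
    anti : AntitoneOn e i (suc k)
    anti l i≤l = ext-antitone l (≤-trans 1≤i i≤l)
    rearrange : ∀ a t u g → a * (t * u) * g ≡ a * (t * g) * u
    rearrange = solve-∀
    PG : prodFrom (suc i) m (λ j → P j * gap e i j) ≡ prodFrom (suc i) m P * G
    PG = trans (prodFrom-* (suc i) m P (gap e i)) (cong (prodFrom (suc i) m P *_)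
      (prodFrom-cong (suc i) m (λ j i<j j<end → cong₂ (λ x y → x ∸ y + (j ∸ i))
        (ext-≤ k μ i≤k) (ext-≤ k μ (subst (j ≤_) (m+[n∸m]≡n i≤k) (s≤s⁻¹ j<end))))))

  denominator-identity :
    ∏pairs k (gap μ) * (prodR 1 k (λ i → (e i ∸ e (suc i)) !) * ∏pairs (suc k) (pochFactor e))
      ≡ prodR 1 k (λ i → (p i ∸ 1) ! * (p i + 1) !)
  denominator-identity = begin
    H * (prodFrom 1 k A * prodFrom 1 (suc k) P)       ≡⟨ cong (λ x → H * (prodFrom 1 k A * x)) (prodFrom-snoc 1 k P) ⟩
    H * (prodFrom 1 k A * (prodFrom 1 k P * P (suc k))) ≡⟨ cong (λ x → H * (prodFrom 1 k A * (prodFrom 1 k P * x))) lastRow-empty ⟩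
    H * (prodFrom 1 k A * (prodFrom 1 k P * 1))       ≡⟨ rearrange H (prodFrom 1 k A) (prodFrom 1 k P) ⟩
    prodFrom 1 k A * prodFrom 1 k P * H               ≡⟨ cong (_* H) (prodFrom-* 1 k A P) ⟨
    prodFrom 1 k (λ i → A i * P i) * H                ≡⟨ prodFrom-* 1 k (λ i → A i * P i) G ⟨
    prodFrom 1 k (λ i → A i * P i * G i)              ≡⟨ prodFrom-cong 1 k (λ i 1≤i i<1+k → row-identity 1≤i (s≤s⁻¹ i<1+k)) ⟩
    prodFrom 1 k (λ i → (p i ∸ 1) ! * (p i + 1) !)    ∎
    where
    A P G : ℕ → ℕ
    A i = (e i ∸ e (suc i)) !
    P i = prodFrom (suc i) (suc k ∸ i) (pochFactor e i)
    G i = prodFrom (suc i) (k ∸ i) (gap μ i)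
    H = prodFrom 1 k G
    lastRow-empty : P (suc k) ≡ 1
    lastRow-empty = cong (λ n → prodFrom (suc (suc k)) n (pochFactor e (suc k))) (n∸n≡0 k)
    rearrange : ∀ h a t → h * (a * (t * 1)) ≡ a * t * h
    rearrange = solve-∀

  size-identity : sumR 1 k p ∸ (k * (k ∸ 1)) / 2 ≡ sumR 1 k μ
  size-identity = begin
    sumFrom 1 k p ∸ (k * (k ∸ 1)) / 2 ≡⟨ cong₂ _∸_ (sumFrom-+ 1 k μ (k ∸_)) triangle ⟩
    sumFrom 1 k μ + D ∸ D             ≡⟨ m+n∸n≡m (sumFrom 1 k μ) D ⟩
    sumFrom 1 k μ                     ∎
    where
    D = sumFrom 1 k (k ∸_)
    triangle : (k * (k ∸ 1)) / 2 ≡ D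
    triangle = trans (cong (_/ 2) (sym (sumFrom-countdown 1 k))) (m*n/n≡m D 2)

  squared-differences : ∏pairs k (λ i j → (p i ∸ p j) * (p i ∸ p j)) ≡ ∏pairs k (gap μ) * ∏pairs k (gap μ)
  squared-differences = trans
    (∏pairs-cong k (λ i j 1≤i i<j j≤k → let p∸p = p∸p≡gap 1≤i (<⇒≤ i<j) j≤k in cong₂ _*_ p∸p p∸p))
    (∏pairs-* k (gap μ) (gap μ))

  f-denominator≢0 : NonZero (prodR 1 k (λ i → (p i ∸ 1) ! * (p i + 1) !))
  f-denominator≢0 = prodFrom-nonZero 1 k _ (λ i → (p i ∸ 1) !* (p i + 1) !≢0)

  g-denominator≢0 : NonZero (prodR 1 k (λ i → (e i ∸ e (suc i)) !) * ∏pairs (suc k) (pochFactor e))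
  g-denominator≢0 = m*n≢0⇒n≢0 (∏pairs k (gap μ)) {{subst NonZero (sym denominator-identity) f-denominator≢0}}

  cross-multiplied :
    (sumR 1 k p ∸ (k * (k ∸ 1)) / 2) ! * ∏pairs k (λ i j → (p i ∸ p j) * (p i ∸ p j))
      * (prodR 1 k (λ i → (e i ∸ e (suc i)) !) * ∏pairs (suc k) (pochFactor e))
    ≡ sumR 1 k μ ! * ∏pairs k (gap μ) * prodR 1 k (λ i → (p i ∸ 1) ! * (p i + 1) !)
  cross-multiplied = begin
    (sumR 1 k p ∸ (k * (k ∸ 1)) / 2) ! * ∏pairs k (λ i j → (p i ∸ p j) * (p i ∸ p j)) * Dg
      ≡⟨ cong₂ (λ s h → s ! * h * Dg) size-identity squared-differences ⟩
    sumR 1 k μ ! * (H * H) * Dg ≡⟨ reassociate (sumR 1 k μ !) H Dg ⟩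
    sumR 1 k μ ! * H * (H * Dg) ≡⟨ cong (sumR 1 k μ ! * H *_) denominator-identity ⟩
    sumR 1 k μ ! * H * prodR 1 k (λ i → (p i ∸ 1) ! * (p i + 1) !) ∎
    where
    H = ∏pairs k (gap μ)
    Dg = prodR 1 k (λ i → (e i ∸ e (suc i)) !) * ∏pairs (suc k) (pochFactor e)
    reassociate : ∀ s h d → s * (h * h) * d ≡ s * h * (h * d)
    reassociate = solve-∀

proposition2p7p1 : (k : ℕ) → 1 ≤ k → (μ : ℕ → ℕ) →
    (∀ i → 1 ≤ i → i < k → μ (suc i) ≤ μ i) → 1 ≤ μ k →
    fk k (λ j → μ j + (k ∸ j)) ≡ gk k μ
proposition2p7p1 k _ μ μ-antitone 1≤μk =
  frac-cross _ _ _ _ {{f-denominator≢0}} {{g-denominator≢0}} cross-multiplied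
  where open Partition k μ μ-antitone 1≤μk
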